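{- Let $G$ be a finite simple undirected graph with maximal cliques $C_1,\dots,C_k$, and let $(A,n)$ be the instance of Valuable Sequence with $A$ the multiset $\{|C_1|,\dots,|C_k|\}$ and $n=|V(G)|$. Then the weight of a minimum-weight solution of $(A,n)$ is a lower bound for the weight of every clique partition of $G$.
   Context: A clique partition of $G$ is a partition of $V(G)$ into sets that are cliques in $G$; its weight is $\prod_{P}(|P|+1)$ over its parts $P$. Valuable Sequence: given a multiset $A$ of natural numbers and a natural number $n$, consider sequences $S=\langle s_1,\dots,s_m\rangle$ with each $s_i\in A$ and each number occurring in $S$ at most as often as in $A$. Let $S_i=\langle s_1,\dots,s_i\rangle$. Values are defined by $\mathrm{val}(s_1)=s_1$ and $\mathrm{val}(s_{i+1})=\min\{s_{i+1},\ \mathrm{val}(s_i),\ n-\mathrm{val}(S_i)\}$, where $\mathrm{val}(S_i)=\sum_{j=1}^{i}\mathrm{val}(s_j)$. The element $s_1$ is always eligible, and $s_{i+1}$ is eligible if $s_{i+1}-\mathrm{val}(S_i)\le \mathrm{val}(s_i)$. $S$ is valid if every element is eligible. The weight of $S$ is $\prod_{i=1}^{m}(\mathrm{val}(s_i)+1)$. A solution is a valid sequence with total value $\mathrm{val}(S_m)=n$; the task is to find a solution of minimum weight. -}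

module Defs where

open import Data.Nat using (ℕ; zero; suc; _+_; _*_; _∸_; _⊓_; _≤_)
open import Data.Fin using (Fin)
open import Data.Fin.Subset using (Subset; _∈_; _∉_; _⊆_; ∣_∣)
open import Data.Fin.Subset.Properties using (_∈?_)
open import Data.List using (List; []; _∷_; map; length; filter)
open import Data.Nat.ListAction using (sum; product)
open import Data.Unit using (⊤)
open import Data.List.Relation.Unary.All using (All)
open import Data.List.Relation.Unary.Unique.Propositional using (Unique)
import Data.List.Membership.Propositional as LM
import Data.List.Relation.Binary.Sublist.Propositional as SL
open import Data.List.Relation.Binary.Permutation.Propositional using (_↭_)
open import Data.Product using (Σ; _×_; _,_)
open import Relation.Binary.PropositionalEquality using (_≡_)
open import Relation.Nullary using (¬_)

record Graph (n : ℕ) : Set₁ where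
  field
    Adj   : Fin n → Fin n → Set
    sym   : ∀ {u v} → Adj u v → Adj v u
    irrefl : ∀ {u} → ¬ Adj u u
open Graph public

IsClique : ∀ {n} → Graph n → Subset n → Set
IsClique G S = ∀ {u v} → u ∈ S → v ∈ S → ¬ (u ≡ v) → Adj G u v

IsMaximalClique : ∀ {n} → Graph n → Subset n → Set
IsMaximalClique G S = IsClique G S × (∀ T → IsClique G T → S ⊆ T → T ⊆ S)

IsMaximalCliqueList : ∀ {n} → Graph n → List (Subset n) → Set
IsMaximalCliqueList G Cs =
  Unique Cs × (∀ S → (S LM.∈ Cs → IsMaximalClique G S) × (IsMaximalClique G S → S LM.∈ Cs))

NonEmptySet : ∀ {n} → Subset n → Set
NonEmptySet {n} S = Σ (Fin n) (λ v → v ∈ S)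

IsCliquePartition : ∀ {n} → Graph n → List (Subset n) → Set
IsCliquePartition {n} G P =
  All (λ p → IsClique G p × NonEmptySet p) P ×
  (∀ (v : Fin n) → length (filter (v ∈?_) P) ≡ 1)

partitionWeight : ∀ {n} → List (Subset n) → ℕ
partitionWeight P = product (map (λ p → ∣ p ∣ + 1) P)

-- S uses each number at most as often as A does (sub-multiset):
-- S is a permutation of a sublist of A.
SubMultiset : List ℕ → List ℕ → Set
SubMultiset S A = Σ (List ℕ) (λ T → (T SL.⊆ A) × (S ↭ T))

-- values of the remaining elements, given n, the value of the previous
-- element p and the total value t so far.
valsFrom : ℕ → ℕ → ℕ → List ℕ → List ℕ
valsFrom n p t [] = []
valsFrom n p t (s ∷ ss) = let v = (s ⊓ p) ⊓ (n ∸ t) in v ∷ valsFrom n v (t + v) ss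

vals : ℕ → List ℕ → List ℕ
vals n [] = []
vals n (s ∷ ss) = s ∷ valsFrom n s s ss

-- eligibility of the remaining elements: s_{i+1} - val(S_i) ≤ val(s_i),
-- i.e. s_{i+1} ≤ val(S_i) + val(s_i) (over the integers).
validFrom : ℕ → ℕ → ℕ → List ℕ → Set
validFrom n p t [] = ⊤
validFrom n p t (s ∷ ss) =
  (s ≤ t + p) × validFrom n ((s ⊓ p) ⊓ (n ∸ t)) (t + ((s ⊓ p) ⊓ (n ∸ t))) ss

Valid : ℕ → List ℕ → Set
Valid n [] = ⊤
Valid n (s ∷ ss) = validFrom n s s ss

seqWeight : ℕ → List ℕ → ℕ
seqWeight n S = product (map (λ v → v + 1) (vals n S))

IsSolution : List ℕ → ℕ → List ℕ → Set
IsSolution A n S = SubMultiset S A × Valid n S × (sum (vals n S) ≡ n)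

-- Sort the maximal cliques by decreasing size. A descending sequence is always valid, and
-- its values are the greedy fill of the budget n, each entry taking as much as it can.
-- Given a clique partition, put every part inside a maximal clique and merge the parts that
-- land in the same clique; since a + b + 1 ≤ (a + 1)(b + 1) this does not increase the weight,
-- and it yields amounts dᵢ ≤ |Cᵢ| that cover all n vertices (only the covering property of the
-- partition is used). Finally the greedy fill minimises ∏ (dᵢ + 1) over such amounts: mass can
-- always be moved onto the front entry, because (x + k + 1)(r + 1) ≤ (x + 1)(k + r + 1) for r ≤ x.

module Submission where

open import Defs hiding (sym)
open import Algebra.Bundles using (CommutativeMonoid)
import Algebra.Properties.CommutativeSemigroup as CommutativeSemigroupProperties
open import Data.Nat
open import Data.Nat.Properties
open import Data.Nat.Tactic.RingSolver using (solve-∀)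
open import Data.Nat.ListAction using (sum; product)
open import Data.Fin using (Fin)
open import Data.Fin.Subset using (Subset; _∈_; _⊆_; _⊂_; _⊃_; ∣_∣; _∪_; ⊥; ⊤; ⋃; inside; outside)
open import Data.Fin.Subset.Properties
  using (_∈?_; _⊆?_; ∣p∣≤n; ∣p∣≤∣x∷p∣; ∣⊥∣≡0; ∣⊤∣≡n; ⊥⊆; ⊆-trans; ⊆-reflexive; p⊆q⇒∣p∣≤∣q∣; p⊂q⇒p⊆q;
         p⊆p∪q; q⊆p∪q; x∈p∪q⁻; x∈p∪q⁺; ∪-assoc; ∪-commutativeMonoid)
open import Data.Fin.Subset.Induction using (Acc; acc; ⊃-wellFounded)
open import Data.Vec using (_∷_; [])
open import Data.List using (List; []; _∷_; map; length; filter)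
open import Data.List.Properties using (map-∘)
open import Data.List.Membership.Propositional using (lose)
open import Data.List.Relation.Unary.All as All using (All; []; _∷_)
import Data.List.Relation.Unary.All.Properties as Allₚ
open import Data.List.Relation.Unary.Any using (Any; here; there; any?)
open import Data.List.Relation.Unary.AllPairs using (AllPairs; []; _∷_)
import Data.List.Relation.Unary.AllPairs.Properties as AllPairsₚ
open import Data.List.Relation.Unary.Sorted.TotalOrder.Properties using (Sorted⇒AllPairs)
open import Data.List.Relation.Binary.Pointwise as Pointwise using (Pointwise; []; _∷_)
open import Data.List.Relation.Binary.Permutation.Propositional using (_↭_; ↭-sym)
open import Data.List.Relation.Binary.Permutation.Propositional.Properties using (Any-resp-↭; map⁺)
import Data.List.Relation.Binary.Sublist.Propositional as Sublist
open import Data.Product using (Σ; ∃-syntax; _×_; _,_; proj₂)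
open import Data.Sum using ([_,_]′; inj₁; inj₂)
open import Data.Unit using (tt)
open import Function using (id)
open import Relation.Binary.Bundles using (DecTotalOrder)
import Relation.Binary.Construct.On as On
open import Relation.Binary.Properties.DecTotalOrder ≤-decTotalOrder using (≥-decTotalOrder)
open import Relation.Binary.PropositionalEquality
open import Relation.Nullary using (¬_; yes; no)
open import Relation.Nullary.Decidable using (decidable-stable; ¬¬-excluded-middle)

private
  module ⊓-CS = CommutativeSemigroupProperties ⊓-commutativeSemigroup
  module *-CS = CommutativeSemigroupProperties *-commutativeSemigroup

weight : List ℕ → ℕ
weight xs = product (map (λ v → v + 1) xs)

Descending : List ℕ → Set
Descending = AllPairs _≥_

infix 4 _≤*_
_≤*_ : List ℕ → List ℕ → Set
_≤*_ = Pointwise _≤_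

greedy : ℕ → List ℕ → List ℕ
greedy m []       = []
greedy m (s ∷ ss) = s ⊓ m ∷ greedy (m ∸ s ⊓ m) ss

suc-sum≤weight : ∀ xs → suc (sum xs) ≤ weight xs
suc-sum≤weight []       = ≤-refl
suc-sum≤weight (x ∷ xs) = begin
  suc (x + sum xs)                ≡⟨ cong suc (+-comm x (sum xs)) ⟩
  suc (sum xs) + x                ≤⟨ +-monoʳ-≤ (suc (sum xs)) (m≤m*n x (suc (sum xs))) ⟩
  suc (sum xs) + x * suc (sum xs) ≡⟨ identity x (sum xs) ⟩
  (x + 1) * suc (sum xs)          ≤⟨ *-monoʳ-≤ (x + 1) (suc-sum≤weight xs) ⟩
  (x + 1) * weight xs             ∎
  where
  open ≤-Reasoning
  identity : ∀ x s → suc s + x * suc s ≡ (x + 1) * suc s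
  identity = solve-∀

weight-greedy-zero : ∀ xs → weight (greedy 0 xs) ≡ 1
weight-greedy-zero []       = refl
weight-greedy-zero (x ∷ xs) rewrite ⊓-zeroʳ x | weight-greedy-zero xs = refl

m+n+1≤[m+1]*[n+1] : ∀ m n → m + n + 1 ≤ (m + 1) * (n + 1)
m+n+1≤[m+1]*[n+1] m n = subst (m + n + 1 ≤_) (identity m n) (m≤m+n (m + n + 1) (m * n))
  where
  identity : ∀ m n → m + n + 1 + m * n ≡ (m + 1) * (n + 1)
  identity = solve-∀

transfer-≤ : ∀ {x r} k → r ≤ x → (x + k + 1) * (r + 1) ≤ (x + 1) * (k + r + 1)
transfer-≤ {x} {r} k r≤x with m≤n⇒∃[o]m+o≡n r≤x
... | q , refl = subst ((r + q + k + 1) * (r + 1) ≤_) (identity r q k) (m≤m+n _ (k * q))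
  where
  identity : ∀ r q k → (r + q + k + 1) * (r + 1) + k * q ≡ (r + q + 1) * (k + r + 1)
  identity = solve-∀

raise-head : ∀ {B} x {ys cs} → x ≤ B → All (_≤ B) cs → ys ≤* cs → B ≤ x + sum ys →
             ∃[ ys′ ] ys′ ≤* cs × x + sum ys ≡ B + sum ys′ × (B + 1) * weight ys′ ≤ (x + 1) * weight ys
raise-head x {[]} {[]} x≤B [] [] B≤x =
  [] , [] , cong (_+ 0) x≡B , ≤-reflexive (cong (λ b → (b + 1) * 1) (sym x≡B))
  where
  x≡B = ≤-antisym x≤B (subst (_ ≤_) (+-identityʳ x) B≤x)
raise-head {B} x {y ∷ ys} x≤B (c≤B ∷ cs≤B) (y≤c ∷ ys≤cs) B≤ with x + y ≤? B
... | yes x+y≤B =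
  let ys′ , ys′≤cs , sum≡ , weight≤ =
        raise-head (x + y) x+y≤B cs≤B ys≤cs (subst (B ≤_) (sym (+-assoc x y (sum ys))) B≤)
  in 0 ∷ ys′ , z≤n ∷ ys′≤cs , trans (sym (+-assoc x y (sum ys))) sum≡ , (begin
    (B + 1) * (1 * weight ys′)      ≡⟨ cong ((B + 1) *_) (*-identityˡ (weight ys′)) ⟩
    (B + 1) * weight ys′            ≤⟨ weight≤ ⟩
    (x + y + 1) * weight ys         ≤⟨ *-monoˡ-≤ (weight ys) (m+n+1≤[m+1]*[n+1] x y) ⟩
    (x + 1) * (y + 1) * weight ys   ≡⟨ *-assoc (x + 1) (y + 1) (weight ys) ⟩
    (x + 1) * ((y + 1) * weight ys) ∎)
  where open ≤-Reasoning
... | no x+y≰B with m≤n⇒∃[o]m+o≡n x≤B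
...   | k , refl with m≤n⇒∃[o]m+o≡n (+-cancelˡ-≤ x k y (<⇒≤ (≰⇒> x+y≰B)))
...     | r , refl =
  r ∷ ys , ≤-trans (m≤n+m r k) y≤c ∷ ys≤cs , reassoc x k r (sum ys) , (begin
    (x + k + 1) * ((r + 1) * weight ys)   ≡⟨ *-assoc (x + k + 1) (r + 1) (weight ys) ⟨
    (x + k + 1) * (r + 1) * weight ys     ≤⟨ *-monoˡ-≤ (weight ys) (transfer-≤ k r≤x) ⟩
    (x + 1) * (k + r + 1) * weight ys     ≡⟨ *-assoc (x + 1) (k + r + 1) (weight ys) ⟩
    (x + 1) * ((k + r + 1) * weight ys)   ∎)
  where
  open ≤-Reasoning
  r≤x : r ≤ x
  r≤x = +-cancelʳ-≤ k r x (subst (_≤ x + k) (+-comm k r) (≤-trans y≤c c≤B))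
  reassoc : ∀ x k r s → x + (k + r + s) ≡ x + k + (r + s)
  reassoc = solve-∀

greedy-optimal : ∀ m {cs ds} → Descending cs → ds ≤* cs → m ≤ sum ds → weight (greedy m cs) ≤ weight ds
greedy-optimal m {[]} {[]} [] [] _ = ≤-refl
greedy-optimal m {c ∷ cs} {d ∷ ds} (c≥cs ∷ desc) (d≤c ∷ ds≤cs) m≤ with m ≤? c
... | yes m≤c rewrite m≥n⇒m⊓n≡n m≤c | n∸n≡0 m | weight-greedy-zero cs = begin
    (m + 1) * 1         ≡⟨ trans (*-identityʳ (m + 1)) (+-comm m 1) ⟩
    suc m               ≤⟨ s≤s m≤ ⟩
    suc (sum (d ∷ ds))  ≤⟨ suc-sum≤weight (d ∷ ds) ⟩
    weight (d ∷ ds)     ∎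
  where open ≤-Reasoning
... | no m≰c =
  let c≤m = <⇒≤ (≰⇒> m≰c)
      ds′ , ds′≤cs , sum≡ , weight≤ = raise-head d d≤c c≥cs ds≤cs (≤-trans c≤m m≤)
      m∸c≤ = m≤n+o⇒m∸n≤o m c (subst (m ≤_) sum≡ m≤)
  in begin
    (c ⊓ m + 1) * weight (greedy (m ∸ c ⊓ m) cs) ≡⟨ cong (λ v → (v + 1) * weight (greedy (m ∸ v) cs)) (m≤n⇒m⊓n≡m c≤m) ⟩
    (c + 1) * weight (greedy (m ∸ c) cs)          ≤⟨ *-monoʳ-≤ (c + 1) (greedy-optimal (m ∸ c) desc ds′≤cs m∸c≤) ⟩
    (c + 1) * weight ds′                           ≤⟨ weight≤ ⟩
    (d + 1) * weight ds                            ∎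
  where open ≤-Reasoning

sum-greedy : ∀ m xs → sum (greedy m xs) ≡ m ⊓ sum xs
sum-greedy m []       = sym (⊓-zeroʳ m)
sum-greedy m (x ∷ xs) with x ≤? m
... | yes x≤m rewrite m≤n⇒m⊓n≡m x≤m | sum-greedy (m ∸ x) xs = begin
  x + (m ∸ x) ⊓ sum xs         ≡⟨ +-distribˡ-⊓ x (m ∸ x) (sum xs) ⟩
  (x + (m ∸ x)) ⊓ (x + sum xs) ≡⟨ cong (_⊓ (x + sum xs)) (m+[n∸m]≡n x≤m) ⟩
  m ⊓ (x + sum xs)             ∎
  where open ≡-Reasoning
... | no x≰m rewrite m≥n⇒m⊓n≡n (<⇒≤ (≰⇒> x≰m)) | n∸n≡0 m | sum-greedy 0 xs =
  trans (+-identityʳ m) (sym (m≤n⇒m⊓n≡m (≤-trans (<⇒≤ (≰⇒> x≰m)) (m≤m+n x (sum xs)))))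

m⊓r≤p⇒m⊓p⊓r≡m⊓r : ∀ {m p r} → m ⊓ r ≤ p → m ⊓ p ⊓ r ≡ m ⊓ r
m⊓r≤p⇒m⊓p⊓r≡m⊓r {m} {p} {r} m⊓r≤p = trans (⊓-CS.xy∙z≈xz∙y m p r) (m≤n⇒m⊓n≡m m⊓r≤p)

valsFrom≡greedy : ∀ n p t {xs} → Descending xs → All (λ x → x ⊓ (n ∸ t) ≤ p) xs →
                  valsFrom n p t xs ≡ greedy (n ∸ t) xs
valsFrom≡greedy n p t {[]} [] [] = refl
valsFrom≡greedy n p t {x ∷ xs} (x≥xs ∷ desc) (x⊓r≤p ∷ _)
  rewrite m⊓r≤p⇒m⊓p⊓r≡m⊓r x⊓r≤p | ∸-+-assoc n t (x ⊓ (n ∸ t)) =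
  cong (x ⊓ (n ∸ t) ∷_) (valsFrom≡greedy n (x ⊓ (n ∸ t)) (t + x ⊓ (n ∸ t)) desc (All.map bounded x≥xs))
  where
  bounded : ∀ {y} → y ≤ x → y ⊓ (n ∸ (t + x ⊓ (n ∸ t))) ≤ x ⊓ (n ∸ t)
  bounded y≤x = ⊓-mono-≤ y≤x (∸-monoʳ-≤ n (m≤m+n t _))

vals≡greedy : ∀ n {xs} → Descending xs → All (_≤ n) xs → vals n xs ≡ greedy n xs
vals≡greedy n {[]} [] [] = refl
vals≡greedy n {x ∷ xs} (x≥xs ∷ desc) (x≤n ∷ _) rewrite m≤n⇒m⊓n≡m x≤n =
  cong (x ∷_) (valsFrom≡greedy n x x desc (All.map (λ y≤x → ≤-trans (m⊓n≤m _ _) y≤x) x≥xs))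

validFrom-bounded : ∀ n p t {xs} → All (_≤ t) xs → validFrom n p t xs
validFrom-bounded n p t []           = tt
validFrom-bounded n p t (x≤t ∷ xs≤t) =
  ≤-trans x≤t (m≤m+n t p) , validFrom-bounded n _ _ (All.map (λ y≤t → ≤-trans y≤t (m≤m+n t _)) xs≤t)

descending⇒Valid : ∀ n {xs} → Descending xs → Valid n xs
descending⇒Valid n []          = tt
descending⇒Valid n (x≥xs ∷ _) = validFrom-bounded n _ _ x≥xs

sum-mono-≤* : ∀ {xs ys} → xs ≤* ys → sum xs ≤ sum ys
sum-mono-≤* []             = ≤-refl
sum-mono-≤* (x≤y ∷ xs≤ys) = +-mono-≤ x≤y (sum-mono-≤* xs≤ys)

descending-solution : ∀ n {cs ds} → Descending cs → All (_≤ n) cs → ds ≤* cs → n ≤ sum ds →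
                      Valid n cs × sum (vals n cs) ≡ n × seqWeight n cs ≤ weight ds
descending-solution n {cs} desc cs≤n ds≤cs n≤ rewrite vals≡greedy n desc cs≤n =
  descending⇒Valid n desc ,
  trans (sum-greedy n cs) (m≤n⇒m⊓n≡m (≤-trans n≤ (sum-mono-≤* ds≤cs))) ,
  greedy-optimal n desc ds≤cs n≤

∣p∪q∣≤∣p∣+∣q∣ : ∀ {n} (p q : Subset n) → ∣ p ∪ q ∣ ≤ ∣ p ∣ + ∣ q ∣
∣p∪q∣≤∣p∣+∣q∣ []            []            = z≤n
∣p∪q∣≤∣p∣+∣q∣ (inside ∷ p)  (s ∷ q)       = s≤s (≤-trans (∣p∪q∣≤∣p∣+∣q∣ p q) (+-monoʳ-≤ ∣ p ∣ (∣p∣≤∣x∷p∣ s q)))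
∣p∪q∣≤∣p∣+∣q∣ (outside ∷ p) (inside ∷ q)  = ≤-trans (s≤s (∣p∪q∣≤∣p∣+∣q∣ p q)) (≤-reflexive (sym (+-suc ∣ p ∣ ∣ q ∣)))
∣p∪q∣≤∣p∣+∣q∣ (outside ∷ p) (outside ∷ q) = ∣p∪q∣≤∣p∣+∣q∣ p q

module _ {n : ℕ} where

  ∪-least : {p q r : Subset n} → p ⊆ r → q ⊆ r → p ∪ q ⊆ r
  ∪-least {p} {q} p⊆r q⊆r x∈p∪q = [ p⊆r , q⊆r ]′ (x∈p∪q⁻ p q x∈p∪q)


  ∪-monoʳ-⊆ : ∀ p {q r : Subset n} → q ⊆ r → p ∪ q ⊆ p ∪ r
  ∪-monoʳ-⊆ p {q} {r} q⊆r = ∪-least (p⊆p∪q r) (⊆-trans q⊆r (q⊆p∪q p r))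

  ∣⋃∣≤sum : (ps : List (Subset n)) → ∣ ⋃ ps ∣ ≤ sum (map ∣_∣ ps)
  ∣⋃∣≤sum []       = ≤-reflexive (∣⊥∣≡0 n)
  ∣⋃∣≤sum (p ∷ ps) = ≤-trans (∣p∪q∣≤∣p∣+∣q∣ p (⋃ ps)) (+-monoʳ-≤ ∣ p ∣ (∣⋃∣≤sum ps))

  ⊤⊆p⇒n≤∣p∣ : {p : Subset n} → ⊤ ⊆ p → n ≤ ∣ p ∣
  ⊤⊆p⇒n≤∣p∣ {p} ⊤⊆p = subst (_≤ ∣ p ∣) (∣⊤∣≡n n) (p⊆q⇒∣p∣≤∣q∣ ⊤⊆p)

  filter-∈-nonempty⇒∈⋃ : ∀ {v : Fin n} ps → 0 < length (filter (v ∈?_) ps) → v ∈ ⋃ ps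
  filter-∈-nonempty⇒∈⋃ {v} (p ∷ ps) nonempty with v ∈? p
  ... | yes v∈p = x∈p∪q⁺ (inj₁ v∈p)
  ... | no  _   = x∈p∪q⁺ (inj₂ (filter-∈-nonempty⇒∈⋃ ps nonempty))

  module _ (F : Subset n → Set) where

    IsMaximal : Subset n → Set
    IsMaximal C = F C × (∀ T → F T → C ⊆ T → T ⊆ C)

    ¬¬maximal-⊇ : ∀ {p} → F p → ¬ ¬ (∃[ C ] IsMaximal C × p ⊆ C)
    ¬¬maximal-⊇ {p} = climb (⊃-wellFounded p)
      where
      climb : ∀ {p} → Acc _⊃_ p → F p → ¬ ¬ (∃[ C ] IsMaximal C × p ⊆ C)
      climb {p} (acc above) Fp ¬goal = ¬¬-excluded-middle {A = ∃[ T ] F T × p ⊂ T} λ where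
        (yes (T , FT , p⊂T)) → climb (above p⊂T) FT λ where
          (C , maxC , T⊆C) → ¬goal (C , maxC , ⊆-trans (p⊂q⇒p⊆q p⊂T) T⊆C)
        (no ¬bigger) → ¬goal (p , (Fp , λ T FT p⊆T {x} x∈T →
          decidable-stable (x ∈? p) λ x∉p → ¬bigger (T , FT , p⊆T , x , x∈T , x∉p)) , id)

  infix 4 _⊆*_
  _⊆*_ : List (Subset n) → List (Subset n) → Set
  _⊆*_ = Pointwise _⊆_

  private
    module ∪-CS = CommutativeSemigroupProperties (CommutativeMonoid.commutativeSemigroup (∪-commutativeMonoid n))

  absorb : ∀ {p Us Cs} → Any (p ⊆_) Cs → Us ⊆* Cs →
           ∃[ Us′ ] Us′ ⊆* Cs × p ∪ ⋃ Us ⊆ ⋃ Us′ × partitionWeight Us′ ≤ (∣ p ∣ + 1) * partitionWeight Us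
  absorb {p} {U ∷ Us} (here p⊆C) (U⊆C ∷ Us⊆Cs) =
    p ∪ U ∷ Us , ∪-least p⊆C U⊆C ∷ Us⊆Cs , ⊆-reflexive (sym (∪-assoc p U (⋃ Us))) , (begin
      (∣ p ∪ U ∣ + 1) * W             ≤⟨ *-monoˡ-≤ W (+-monoˡ-≤ 1 (∣p∪q∣≤∣p∣+∣q∣ p U)) ⟩
      (∣ p ∣ + ∣ U ∣ + 1) * W         ≤⟨ *-monoˡ-≤ W (m+n+1≤[m+1]*[n+1] ∣ p ∣ ∣ U ∣) ⟩
      (∣ p ∣ + 1) * (∣ U ∣ + 1) * W   ≡⟨ *-assoc (∣ p ∣ + 1) (∣ U ∣ + 1) W ⟩
      (∣ p ∣ + 1) * ((∣ U ∣ + 1) * W) ∎)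
    where
    open ≤-Reasoning
    W = partitionWeight Us
  absorb {p} {U ∷ Us} (there p⊆Cs) (U⊆C ∷ Us⊆Cs) =
    let Us′ , Us′⊆Cs , covered , weight≤ = absorb p⊆Cs Us⊆Cs
    in U ∷ Us′ , U⊆C ∷ Us′⊆Cs ,
       ⊆-trans (⊆-reflexive (∪-CS.x∙yz≈y∙xz p U (⋃ Us))) (∪-monoʳ-⊆ U covered) , (begin
      (∣ U ∣ + 1) * partitionWeight Us′ ≤⟨ *-monoʳ-≤ (∣ U ∣ + 1) weight≤ ⟩
      (∣ U ∣ + 1) * ((∣ p ∣ + 1) * W)   ≡⟨ *-CS.x∙yz≈y∙xz (∣ U ∣ + 1) (∣ p ∣ + 1) W ⟩
      (∣ p ∣ + 1) * ((∣ U ∣ + 1) * W)   ∎)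
    where
    open ≤-Reasoning
    W = partitionWeight Us

  empties : ∀ Cs → ∃[ Us ] Us ⊆* Cs × partitionWeight Us ≡ 1
  empties []       = [] , [] , refl
  empties (C ∷ Cs) =
    let Us , Us⊆Cs , weight≡1 = empties Cs
    in ⊥ ∷ Us , ⊥⊆ ∷ Us⊆Cs , cong₂ (λ a b → (a + 1) * b) (∣⊥∣≡0 n) weight≡1

  merge : ∀ Cs {P} → All (λ p → Any (p ⊆_) Cs) P →
          ∃[ Us ] Us ⊆* Cs × ⋃ P ⊆ ⋃ Us × partitionWeight Us ≤ partitionWeight P
  merge Cs [] = let Us , Us⊆Cs , weight≡1 = empties Cs in Us , Us⊆Cs , ⊥⊆ , ≤-reflexive weight≡1
  merge Cs {p ∷ P} (p⊆C ∷ P⊆Cs) =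
    let Us , Us⊆Cs , covered , weight≤ = merge Cs P⊆Cs
        Us′ , Us′⊆Cs , covered′ , weight≤′ = absorb p⊆C Us⊆Cs
    in Us′ , Us′⊆Cs , ⊆-trans (∪-monoʳ-⊆ p covered) covered′ , ≤-trans weight≤′ (*-monoʳ-≤ (∣ p ∣ + 1) weight≤)

  BySize : DecTotalOrder _ _ _
  BySize = On.decTotalOrder ≥-decTotalOrder (∣_∣ {n})

  open import Data.List.Sort BySize using (sort; sort-↭; sort-↗)

  sortBySize : List (Subset n) → List (Subset n)
  sortBySize = sort

  sortBySize-↭ : ∀ Cs → sortBySize Cs ↭ Cs
  sortBySize-↭ = sort-↭

  sortBySize-descending : ∀ Cs → Descending (map ∣_∣ (sortBySize Cs))
  sortBySize-descending Cs = AllPairsₚ.map⁺ (Sorted⇒AllPairs (DecTotalOrder.totalOrder BySize) (sort-↗ Cs))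

  cover-sizes : ∀ Cs {P} → All (λ p → Any (p ⊆_) Cs) P → ⊤ ⊆ ⋃ P →
                ∃[ ds ] ds ≤* map ∣_∣ Cs × n ≤ sum ds × weight ds ≤ partitionWeight P
  cover-sizes Cs P⊆Cs covering =
    let Us , Us⊆Cs , covered , weight≤ = merge Cs P⊆Cs
    in map ∣_∣ Us , Pointwise.map⁺ ∣_∣ ∣_∣ (Pointwise.map p⊆q⇒∣p∣≤∣q∣ Us⊆Cs) ,
       ≤-trans (⊤⊆p⇒n≤∣p∣ (⊆-trans covering covered)) (∣⋃∣≤sum Us) ,
       ≤-trans (≤-reflexive (cong product (sym (map-∘ Us)))) weight≤

lemma9 : (n : ℕ) (G : Graph n) (Cs : List (Subset n)) → IsMaximalCliqueList G Cs → (P : List (Subset n)) → IsCliquePartition G P → Σ (List ℕ) (λ S → IsSolution (map ∣_∣ Cs) n S × (seqWeight n S ≤ partitionWeight P))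
lemma9 n G Cs (_ , maximal) P (parts , counts) =
  let ds , ds≤ , n≤ , weight≤ = cover-sizes (sortBySize Cs) (All.map inMaximalClique parts) covering
      valid , sum≡n , seqWeight≤ = descending-solution n (sortBySize-descending Cs) sizes≤n ds≤ n≤
  in map ∣_∣ (sortBySize Cs) , ((map ∣_∣ Cs , Sublist.⊆-refl , map⁺ ∣_∣ (sortBySize-↭ Cs)) , valid , sum≡n) ,
     ≤-trans seqWeight≤ weight≤
  where
  -- A maximal clique above p exists only up to double negation (adjacency is not decidable),
  -- but containment in one of the listed cliques is decidable.
  inMaximalClique : ∀ {p} → IsClique G p × NonEmptySet p → Any (p ⊆_) (sortBySize Cs)
  inMaximalClique {p} (clique , _) = decidable-stable (any? (p ⊆?_) (sortBySize Cs)) λ ¬inside →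
    ¬¬maximal-⊇ (IsClique G) clique λ (C , maximalC , p⊆C) →
      ¬inside (Any-resp-↭ (↭-sym (sortBySize-↭ Cs)) (lose (proj₂ (maximal C) maximalC) p⊆C))
  covering : ⊤ ⊆ ⋃ P
  covering {v} _ = filter-∈-nonempty⇒∈⋃ P (subst (0 <_) (sym (counts v)) (s≤s z≤n))
  sizes≤n : All (_≤ n) (map ∣_∣ (sortBySize Cs))
  sizes≤n = Allₚ.map⁺ (All.tabulate (λ {C} _ → ∣p∣≤n C))
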